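{- Let $(G,\sigma)$ be a signed graph (with $G=(V,E)$ a finite loopless multigraph) and let $D$ be a biorientation of $G$ such that every edge $e\in E^-(G)$ is oriented in both directions in $D$ and the biorientation of $G^+$ induced by $D$ is kernel-perfect. If $L=\{L(v)\}_{v\in V}$ is a list assignment with $L(v)\subseteq \mathbb{Z}\setminus\{0\}$ and $|L(v)|\geq d^+_D(v)+1$ for each $v\in V$, then $(G,\sigma)$ is $L$-colorable.
   Context: A signed graph is a pair $(G,\sigma)$ with $\sigma:E(G)\to\{ -1,1\}$. $E^+(G)$ and $E^-(G)$ are the sets of edges with sign $1$ and $-1$ respectively, and $G^+=(V,E^+(G))$. Given lists $L(v)\subseteq\mathbb{Z}$, $(G,\sigma)$ is $L$-colorable if there is $\psi$ with $\psi(v)\in L(v)$ for all $v$ and $\psi(v)\neq\sigma(e)\psi(w)$ for every edge $e=\{v,w\}$. A biorientation of $G$ is a digraph $D$ on $V(G)$ in which each edge $\{u,v\}$ is replaced by the arc $(u,v)$, the arc $(v,u)$, or both; $d^+_D(v)$ is the out-degree in $D$; the biorientation of $G^+$ induced by $D$ is the subdigraph of $D$ consisting of arcs coming from edges of $G^+$. A kernel of a digraph is an independent vertex set $U$ such that every vertex $v\notin U$ has an arc $(v,u)$ to some $u\in U$; a digraph is kernel-perfect if every induced subdigraph has a kernel. -}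

module Defs where

open import Level using (0ℓ)
open import Data.Nat using (ℕ; zero; suc; _+_; _≤_)
open import Data.Fin using (Fin; _≟_)
open import Data.Fin.Subset using (Subset; _∈_; _∉_; _⊆_)
open import Data.List using (List; map; allFin)
open import Data.Nat.ListAction using (sum)
open import Data.Integer using (ℤ; _*_; -_) renaming (+_ to ⁺_)
open import Data.Product using (Σ; ∃; ∃-syntax; _×_; _,_)
open import Data.Sum using (_⊎_)
open import Relation.Nullary using (¬_; yes; no)
open import Relation.Unary using (Pred)
open import Relation.Binary.PropositionalEquality using (_≡_; _≢_)
open import Function.Definitions using (Injective)

record Multigraph (n m : ℕ) : Set where
  field
    end₁ : Fin m → Fin n
    end₂ : Fin m → Fin n
    loopless : ∀ e → end₁ e ≢ end₂ e
open Multigraph public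

data Sign : Set where
  pos neg : Sign

signℤ : Sign → ℤ
signℤ pos = ⁺ 1
signℤ neg = - (⁺ 1)

-- A biorientation: each edge gets the arc end₁→end₂ (fwd), end₂→end₁ (bwd), or both.
data Orient : Set where
  fwd bwd both : Orient

hasFwd : Orient → ℕ
hasFwd fwd = 1
hasFwd bwd = 0
hasFwd both = 1

hasBwd : Orient → ℕ
hasBwd fwd = 0
hasBwd bwd = 1
hasBwd both = 1

Fwd : Orient → Set
Fwd o = hasFwd o ≡ 1

Bwd : Orient → Set
Bwd o = hasBwd o ≡ 1

outArcs : ∀ {n m} → Multigraph n m → (Fin m → Orient) → Fin n → Fin m → ℕ
outArcs G D v e with end₁ G e ≟ v | end₂ G e ≟ v
... | yes _ | yes _ = hasFwd (D e) + hasBwd (D e)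
... | yes _ | no  _ = hasFwd (D e)
... | no  _ | yes _ = hasBwd (D e)
... | no  _ | no  _ = 0

outdeg : ∀ {n m} → Multigraph n m → (Fin m → Orient) → Fin n → ℕ
outdeg {m = m} G D v = sum (map (outArcs G D v) (allFin m))

PosArc : ∀ {n m} → Multigraph n m → (Fin m → Sign) → (Fin m → Orient) →
         Fin n → Fin n → Set
PosArc {m = m} G σ D u v =
  ∃[ e ] (σ e ≡ pos ×
          ((end₁ G e ≡ u × end₂ G e ≡ v × Fwd (D e)) ⊎
           (end₂ G e ≡ u × end₁ G e ≡ v × Bwd (D e))))

IsKernelOf : ∀ {n} → (Fin n → Fin n → Set) → Subset n → Subset n → Set
IsKernelOf Arc S U =
  U ⊆ S ×
  (∀ {u v} → u ∈ U → v ∈ U → ¬ Arc u v) ×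
  (∀ {v} → v ∈ S → v ∉ U → ∃[ u ] (u ∈ U × Arc v u))

KernelPerfect : ∀ {n} → (Fin n → Fin n → Set) → Set
KernelPerfect {n} Arc = ∀ (S : Subset n) → ∃[ U ] IsKernelOf Arc S U

HasAtLeast : ℕ → Pred ℤ 0ℓ → Set
HasAtLeast k P = Σ (Fin k → ℤ) λ f → Injective _≡_ _≡_ f × (∀ i → f i ∈P)
  where
  _∈P : ℤ → Set
  x ∈P = P x

Colorable : ∀ {n m} → Multigraph n m → (Fin m → Sign) → (Fin n → Pred ℤ 0ℓ) → Set
Colorable {n} {m} G σ L =
  Σ (Fin n → ℤ) λ ψ → (∀ v → L v (ψ v)) ×
    (∀ (e : Fin m) → ψ (end₁ G e) ≢ signℤ (σ e) * ψ (end₂ G e))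

module Submission where

open import Defs
open import Level using (0ℓ)
open import Data.Nat using (ℕ; suc)
open import Data.Fin using (Fin)
open import Data.Integer using (ℤ; 0ℤ)
open import Relation.Unary using (Pred)
open import Relation.Nullary using (¬_)
open import Relation.Binary.PropositionalEquality using (_≡_)

open import Data.Bool using (true; false; if_then_else_)
open import Data.Nat using (zero; _+_; _*_; _≤_; z≤n; s≤s)
open import Data.Nat.Properties
  using (≤-trans; ≤-reflexive; +-mono-≤; +-monoʳ-≤; +-suc; m≤m+n; m≤n+m; +-identityʳ; *-identityʳ;
         *-distribˡ-+; +-cancelʳ-≤; +-commutativeSemigroup; module ≤-Reasoning)
open import Data.Nat.Tactic.RingSolver using (solve-∀)
open import Algebra.Properties.CommutativeSemigroup +-commutativeSemigroup using () renaming (interchange to +-interchange)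
open import Data.Nat.ListAction using (sum)
open import Data.Fin using (zero; suc) renaming (_≟_ to _≟ᶠ_)
open import Data.Fin.Subset using (Subset; _∈_; _∉_; _⊆_; _⊂_; _∩_; _─_; ⊤; inside; outside)
open import Data.Fin.Subset.Properties
  using (∈⊤; drop-∷-⊆; _∈?_; nonempty?; x∈p∩q⁺; x∈p∩q⁻; p─q⊆p; x∈p∧x∉q⇒x∈p─q; p∩q≢∅⇒p─q⊂p)
open import Data.Fin.Subset.Induction using (⊂-wellFounded)
open import Data.Integer using (-_; -[1+_]; +[1+_]; +0) renaming (_≟_ to _≟ℤ_; _*_ to _*ℤ_)
open import Data.Integer.Properties using (-1*i≡-i; neg-involutive) renaming (*-identityˡ to *ℤ-identityˡ)
open import Data.List using (List; []; _∷_; length; map; allFin; tabulate; filter)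
open import Data.List.Properties using (length-tabulate; map-cong)
open import Data.List.Membership.Propositional using () renaming (_∈_ to _∈ˡ_; _∉_ to _∉ˡ_)
open import Data.List.Membership.Propositional.Properties using (∈-allFin; ∈-tabulate⁻; ∈-filter⁻)
open import Data.List.Membership.DecPropositional _≟ℤ_ using () renaming (_∈?_ to _∈ˡ?_)
import Data.List.Relation.Unary.Any as Any
import Data.List.Relation.Unary.All as All
open import Data.List.Relation.Unary.AllPairs using (_∷_)
open import Data.List.Relation.Unary.Unique.Propositional using (Unique)
open import Data.List.Relation.Unary.Unique.Propositional.Properties using (filter⁺; tabulate⁺)
open import Data.Vec using (_∷_; lookup; here; there) renaming (tabulate to tabulateᵛ)
open import Data.Vec.Properties using (lookup∘tabulate; []=⇒lookup; lookup⇒[]=; lookup-replicate)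
open import Data.Product using (Σ; ∃-syntax; _×_; _,_; proj₁; proj₂)
open import Data.Sum using (_⊎_; inj₁; inj₂; [_,_]′)
open import Data.Empty using (⊥-elim)
open import Function using (_∘_)
open import Induction.WellFounded using (WfRec)
import Induction.WellFounded as WF
open import Relation.Nullary using (yes; no; does; ¬?)
open import Relation.Nullary.Decidable using (dec-true)
open import Relation.Unary using (Decidable)
open import Relation.Binary.Definitions using (DecidableEquality)
open import Relation.Binary.PropositionalEquality using (_≢_; refl; sym; trans; cong; cong₂; subst; module ≡-Reasoning)

-- Induction on the set R of vertices still to be coloured, the lists being longer than the
-- out-degrees into R.  Pick a colour c from some list, let S be the vertices of R whose list
-- contains c, and colour a kernel U of the positive digraph on S with c: U spans no positive arc,
-- and a negative edge inside U is harmless because c ≠ −c.  A vertex w ∈ R ∖ U drops c from its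
-- list only if c ∈ L(w), and then w ∈ S ∖ U has a positive arc into U; it drops −c only if it has
-- a negative edge to U, which is bidirected and so is an arc of w into U.  Every lost colour is
-- thus paid for by an arc of w into U, so R ∖ U with the shortened lists satisfies the hypothesis.

sum-map-+ : ∀ {A : Set} (f g : A → ℕ) xs →
            sum (map (λ x → f x + g x) xs) ≡ sum (map f xs) + sum (map g xs)
sum-map-+ f g [] = refl
sum-map-+ f g (x ∷ xs) = begin
  f x + g x + sum (map (λ x → f x + g x) xs)  ≡⟨ cong (f x + g x +_) (sum-map-+ f g xs) ⟩
  f x + g x + (sum (map f xs) + sum (map g xs)) ≡⟨ +-interchange (f x) (g x) _ _ ⟩
  f x + sum (map f xs) + (g x + sum (map g xs)) ∎
  where open ≡-Reasoning

∈⇒≤sum-map : ∀ {A : Set} (f : A → ℕ) {x xs} → x ∈ˡ xs → f x ≤ sum (map f xs)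
∈⇒≤sum-map f {xs = y ∷ ys} (Any.here refl) = m≤m+n (f y) _
∈⇒≤sum-map f {xs = y ∷ ys} (Any.there x∈) = ≤-trans (∈⇒≤sum-map f x∈) (m≤n+m _ (f y))

nonempty-list : ∀ {A : Set} {xs : List A} {k} → suc k ≤ length xs → ∃[ x ] x ∈ˡ xs
nonempty-list {xs = x ∷ _} _ = x , Any.here refl

module _ {A : Set} (_≟_ : DecidableEquality A) where

  without : A → List A → List A
  without c = filter (λ x → ¬? (x ≟ c))

  ∈-without⁻ : ∀ {c x xs} → x ∈ˡ without c xs → x ∈ˡ xs × x ≢ c
  ∈-without⁻ {c} {xs = xs} = ∈-filter⁻ (λ x → ¬? (x ≟ c)) {xs = xs}

  without-unique : ∀ {c xs} → Unique xs → Unique (without c xs)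
  without-unique {c} = filter⁺ (λ x → ¬? (x ≟ c))

  length-without : ∀ {c} k {xs} → Unique xs → (c ∈ˡ xs → 1 ≤ k) →
                   length xs ≤ k + length (without c xs)
  length-without k {[]} _ _ = z≤n
  length-without {c} k {x ∷ xs} (x∉xs ∷ u) c∈→ with x ≟ c
  ... | yes refl = +-mono-≤ (c∈→ (Any.here refl))
                     (length-without 0 u (λ c∈xs → ⊥-elim (All.lookup x∉xs c∈xs refl)))
  ... | no _ = ≤-trans (s≤s (length-without k u (c∈→ ∘ Any.there)))
                       (≤-reflexive (sym (+-suc k _)))

  withoutIfPositive : ℕ → A → List A → List A
  withoutIfPositive zero    c xs = xs
  withoutIfPositive (suc _) c xs = without c xs

  ∈-withoutIfPositive⁻ : ∀ k {c x xs} → x ∈ˡ withoutIfPositive k c xs → x ∈ˡ xs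
  ∈-withoutIfPositive⁻ zero    x∈ = x∈
  ∈-withoutIfPositive⁻ (suc _) x∈ = proj₁ (∈-without⁻ x∈)

  withoutIfPositive-avoids : ∀ {k c x xs} → 1 ≤ k → x ∈ˡ withoutIfPositive k c xs → x ≢ c
  withoutIfPositive-avoids {suc _} {xs = xs} _ x∈ = proj₂ (∈-without⁻ {xs = xs} x∈)

  withoutIfPositive-unique : ∀ k {c xs} → Unique xs → Unique (withoutIfPositive k c xs)
  withoutIfPositive-unique zero    u = u
  withoutIfPositive-unique (suc _) u = without-unique u

  length-withoutIfPositive : ∀ k {c xs} → Unique xs →
                             length xs ≤ k + length (withoutIfPositive k c xs)
  length-withoutIfPositive zero    _ = ≤-reflexive refl
  length-withoutIfPositive (suc k) u = length-without (suc k) u (λ _ → s≤s z≤n)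

distinctLists : ∀ {n} {k : Fin n → ℕ} {L : Fin n → Pred ℤ 0ℓ} → (∀ v → HasAtLeast (k v) (L v)) →
                ∃[ l ] (∀ v → Unique (l v)) × (∀ v → length (l v) ≡ k v) × (∀ v {x} → x ∈ˡ l v → L v x)
distinctLists {L = L} large =
  (λ v → tabulate (proj₁ (large v))) , (λ v → tabulate⁺ (proj₁ (proj₂ (large v)))) ,
  (λ v → length-tabulate (proj₁ (large v))) , tabulate⊆L
  where
  tabulate⊆L : ∀ v {x} → x ∈ˡ tabulate (proj₁ (large v)) → L v x
  tabulate⊆L v x∈ with i , refl ← ∈-tabulate⁻ x∈ = proj₂ (proj₂ (large v)) i

i≢-i : ∀ {i} → i ≢ 0ℤ → i ≢ - i
i≢-i {+0}       i≢0 = λ _ → i≢0 refl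
i≢-i {+[1+ _ ]} _   = λ ()
i≢-i { -[1+ _ ] } _ = λ ()

signℤ-involutive : ∀ s i → signℤ s *ℤ (signℤ s *ℤ i) ≡ i
signℤ-involutive pos i = trans (*ℤ-identityˡ _) (*ℤ-identityˡ i)
signℤ-involutive neg i = trans (-1*i≡-i _) (trans (cong -_ (-1*i≡-i i)) (neg-involutive i))

signℤ-flip : ∀ s {i j} → i ≡ signℤ s *ℤ j → j ≡ signℤ s *ℤ i
signℤ-flip s {i} {j} i≡ = trans (sym (signℤ-involutive s j)) (cong (signℤ s *ℤ_) (sym i≡))

satisfying : ∀ {n} {P : Pred (Fin n) 0ℓ} → Decidable P → Subset n
satisfying P? = tabulateᵛ (does ∘ P?)

∈-satisfying⁺ : ∀ {n} {P : Pred (Fin n) 0ℓ} (P? : Decidable P) {x} → P x → x ∈ satisfying P?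
∈-satisfying⁺ P? {x} px = lookup⇒[]= x _ (trans (lookup∘tabulate _ x) (dec-true (P? x) px))

∈-satisfying⁻ : ∀ {n} {P : Pred (Fin n) 0ℓ} (P? : Decidable P) {x} → x ∈ satisfying P? → P x
∈-satisfying⁻ P? {x} x∈ with P? x | trans (sym (lookup∘tabulate (does ∘ P?) x)) ([]=⇒lookup x∈)
... | yes px | _ = px

χ : ∀ {n} → Subset n → Fin n → ℕ
χ R x = if lookup R x then 1 else 0

χ-∈ : ∀ {n} {R : Subset n} {x} → x ∈ R → χ R x ≡ 1
χ-∈ x∈R rewrite []=⇒lookup x∈R = refl

χ-⊤ : ∀ {n} (x : Fin n) → χ ⊤ x ≡ 1
χ-⊤ x rewrite lookup-replicate x inside = refl

χ-─ : ∀ {n} {R U : Subset n} → U ⊆ R → ∀ x → χ R x ≡ χ (R ─ U) x + χ U x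
χ-─ {R = r ∷ _} {outside ∷ _} _   zero    = sym (+-identityʳ (if r then 1 else 0))
χ-─ {R = inside ∷ _} {inside ∷ _} _ zero  = refl
χ-─ {R = outside ∷ _} {inside ∷ _} U⊆R zero with () ← U⊆R here
χ-─ {R = _ ∷ _} {_ ∷ _} U⊆R (suc x) = χ-─ (drop-∷-⊆ U⊆R) x

x∈p─q⇒x∉q : ∀ {n} {x : Fin n} {p q : Subset n} → x ∈ p ─ q → x ∉ q
x∈p─q⇒x∉q {p = _ ∷ _} {outside ∷ _} here ()
x∈p─q⇒x∉q {p = _ ∷ _} {_ ∷ _} (there x∈) (there x∈q) = x∈p─q⇒x∉q x∈ x∈q

χ-─-scaled : ∀ {n} {R U : Subset n} → U ⊆ R → ∀ b k x →
             (if b then k * χ R x else 0) ≡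
             (if b then k * χ (R ─ U) x else 0) + (if b then k * χ U x else 0)
χ-─-scaled U⊆R true  k x = trans (cong (k *_) (χ-─ U⊆R x)) (*-distribˡ-+ k _ _)
χ-─-scaled U⊆R false _ _ = refl

signPart : Sign → Sign → ℕ → ℕ
signPart pos pos k = k
signPart neg neg k = k
signPart _   _   _ = 0

signPart-diag : ∀ s k → signPart s s k ≡ k
signPart-diag pos k = refl
signPart-diag neg k = refl

signPart-split : ∀ s k → k ≡ signPart pos s k + signPart neg s k
signPart-split pos k = sym (+-identityʳ k)
signPart-split neg k = refl

module Biorientation {n m : ℕ} (G : Multigraph n m) (σ : Fin m → Sign) (D : Fin m → Orient) where

  fwdArcsInto bwdArcsInto arcsInto : Subset n → Fin n → Fin m → ℕ
  fwdArcsInto R w e = if does (end₁ G e ≟ᶠ w) then hasFwd (D e) * χ R (end₂ G e) else 0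
  bwdArcsInto R w e = if does (end₂ G e ≟ᶠ w) then hasBwd (D e) * χ R (end₁ G e) else 0
  arcsInto R w e = fwdArcsInto R w e + bwdArcsInto R w e

  degInto : Subset n → Fin n → ℕ
  degInto R w = sum (map (arcsInto R w) (allFin m))

  signedDegInto : Sign → Subset n → Fin n → ℕ
  signedDegInto s R w = sum (map (λ e → signPart s (σ e) (arcsInto R w e)) (allFin m))

  arcsInto-⊤ : ∀ w e → arcsInto ⊤ w e ≡ outArcs G D w e
  arcsInto-⊤ w e rewrite χ-⊤ (end₁ G e) | χ-⊤ (end₂ G e)
    with end₁ G e ≟ᶠ w | end₂ G e ≟ᶠ w
  ... | yes _ | yes _ = cong₂ _+_ (*-identityʳ (hasFwd (D e))) (*-identityʳ (hasBwd (D e)))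
  ... | yes _ | no  _ = trans (+-identityʳ _) (*-identityʳ _)
  ... | no  _ | yes _ = *-identityʳ _
  ... | no  _ | no  _ = refl

  degInto-⊤ : ∀ w → degInto ⊤ w ≡ outdeg G D w
  degInto-⊤ w = cong sum (map-cong (arcsInto-⊤ w) (allFin m))

  arcsInto-─ : ∀ {R U} → U ⊆ R → ∀ w e → arcsInto R w e ≡ arcsInto (R ─ U) w e + arcsInto U w e
  arcsInto-─ {R} {U} U⊆R w e =
    trans (cong₂ _+_ (χ-─-scaled U⊆R (does (end₁ G e ≟ᶠ w)) (hasFwd (D e)) (end₂ G e))
                     (χ-─-scaled U⊆R (does (end₂ G e ≟ᶠ w)) (hasBwd (D e)) (end₁ G e)))
          (+-interchange (fwdArcsInto (R ─ U) w e) (fwdArcsInto U w e)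
                         (bwdArcsInto (R ─ U) w e) (bwdArcsInto U w e))

  degInto-─ : ∀ {R U} → U ⊆ R → ∀ w →
              degInto R w ≡ degInto (R ─ U) w + (signedDegInto pos U w + signedDegInto neg U w)
  degInto-─ {R} {U} U⊆R w = begin
    degInto R w
      ≡⟨ cong sum (map-cong split (allFin m)) ⟩
    sum (map (λ e → arcsInto (R ─ U) w e + (posPart e + negPart e)) (allFin m))
      ≡⟨ sum-map-+ (arcsInto (R ─ U) w) _ (allFin m) ⟩
    degInto (R ─ U) w + sum (map (λ e → posPart e + negPart e) (allFin m))
      ≡⟨ cong (degInto (R ─ U) w +_) (sum-map-+ posPart negPart (allFin m)) ⟩
    degInto (R ─ U) w + (signedDegInto pos U w + signedDegInto neg U w) ∎
    where
    open ≡-Reasoning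
    posPart negPart : Fin m → ℕ
    posPart e = signPart pos (σ e) (arcsInto U w e)
    negPart e = signPart neg (σ e) (arcsInto U w e)
    split : ∀ e → arcsInto R w e ≡ arcsInto (R ─ U) w e + (posPart e + negPart e)
    split e = trans (arcsInto-─ U⊆R w e)
                    (cong (arcsInto (R ─ U) w e +_) (signPart-split (σ e) (arcsInto U w e)))

  arcsInto≤signedDegInto : ∀ {s} R w e → σ e ≡ s → arcsInto R w e ≤ signedDegInto s R w
  arcsInto≤signedDegInto {s} R w e σe≡s =
    ≤-trans (≤-reflexive (sym (trans (cong (λ t → signPart s t (arcsInto R w e)) σe≡s)
                                     (signPart-diag s (arcsInto R w e)))))
            (∈⇒≤sum-map (λ e → signPart s (σ e) (arcsInto R w e)) (∈-allFin e))

  arcsInto-fwd : ∀ {R} e → end₂ G e ∈ R → Fwd (D e) → 1 ≤ arcsInto R (end₁ G e) e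
  arcsInto-fwd e y∈R isFwd
    rewrite dec-true (end₁ G e ≟ᶠ end₁ G e) refl | isFwd | χ-∈ y∈R = s≤s z≤n

  arcsInto-bwd : ∀ {R} e → end₁ G e ∈ R → Bwd (D e) → 1 ≤ arcsInto R (end₂ G e) e
  arcsInto-bwd {R} e y∈R isBwd
    rewrite dec-true (end₂ G e ≟ᶠ end₂ G e) refl | isBwd | χ-∈ y∈R =
    m≤n+m 1 (fwdArcsInto R (end₂ G e) e)

  posArc⇒posDegInto : ∀ {R w y} → y ∈ R → PosArc G σ D w y → 1 ≤ signedDegInto pos R w
  posArc⇒posDegInto {R} y∈R (e , σe≡pos , inj₁ (refl , refl , isFwd)) =
    ≤-trans (arcsInto-fwd e y∈R isFwd) (arcsInto≤signedDegInto R _ e σe≡pos)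
  posArc⇒posDegInto {R} y∈R (e , σe≡pos , inj₂ (refl , refl , isBwd)) =
    ≤-trans (arcsInto-bwd e y∈R isBwd) (arcsInto≤signedDegInto R _ e σe≡pos)

  negEdge⇒negDegInto₁ : ∀ {R} e → σ e ≡ neg → D e ≡ both → end₂ G e ∈ R →
                        1 ≤ signedDegInto neg R (end₁ G e)
  negEdge⇒negDegInto₁ {R} e σe≡neg De≡both y∈R =
    ≤-trans (arcsInto-fwd e y∈R (cong hasFwd De≡both)) (arcsInto≤signedDegInto R _ e σe≡neg)

  negEdge⇒negDegInto₂ : ∀ {R} e → σ e ≡ neg → D e ≡ both → end₁ G e ∈ R →
                        1 ≤ signedDegInto neg R (end₂ G e)
  negEdge⇒negDegInto₂ {R} e σe≡neg De≡both y∈R =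
    ≤-trans (arcsInto-bwd e y∈R (cong hasBwd De≡both)) (arcsInto≤signedDegInto R _ e σe≡neg)

  posEdge⇒posArc : ∀ e → σ e ≡ pos →
                   PosArc G σ D (end₁ G e) (end₂ G e) ⊎ PosArc G σ D (end₂ G e) (end₁ G e)
  posEdge⇒posArc e σe≡pos with D e in De
  ... | fwd  = inj₁ (e , σe≡pos , inj₁ (refl , refl , cong hasFwd De))
  ... | bwd  = inj₂ (e , σe≡pos , inj₂ (refl , refl , cong hasBwd De))
  ... | both = inj₁ (e , σe≡pos , inj₁ (refl , refl , cong hasFwd De))

  ProperOn : Subset n → (Fin n → ℤ) → Set
  ProperOn R ψ = ∀ e → end₁ G e ∈ R → end₂ G e ∈ R → ψ (end₁ G e) ≢ signℤ (σ e) *ℤ ψ (end₂ G e)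

  DegreeColourable : Subset n → Set
  DegreeColourable R =
    (l : Fin n → List ℤ) → (∀ v → Unique (l v)) → (∀ v → 0ℤ ∉ˡ l v) →
    (∀ {v} → v ∈ R → suc (degInto R v) ≤ length (l v)) →
    Σ (Fin n → ℤ) λ ψ → (∀ {v} → v ∈ R → ψ v ∈ˡ l v) × ProperOn R ψ

  module _ (negBoth : ∀ e → σ e ≡ neg → D e ≡ both)
           (kernelPerfect : KernelPerfect (PosArc G σ D)) where

    module KernelStep
      {R : Subset n} (rec : WfRec _⊂_ DegreeColourable R)
      (l : Fin n → List ℤ) (uniq : ∀ v → Unique (l v)) (no0 : ∀ v → 0ℤ ∉ˡ l v)
      (long : ∀ {v} → v ∈ R → suc (degInto R v) ≤ length (l v))
      {v₀ : Fin n} (v₀∈R : v₀ ∈ R) {c : ℤ} (c∈l : c ∈ˡ l v₀) where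

      c≢0 : c ≢ 0ℤ
      c≢0 refl = no0 v₀ c∈l

      S : Subset n
      S = R ∩ satisfying (λ x → c ∈ˡ? l x)

      U : Subset n
      U = proj₁ (kernelPerfect S)

      U⊆S : U ⊆ S
      U⊆S = proj₁ (proj₂ (kernelPerfect S))

      independent : ∀ {x y} → x ∈ U → y ∈ U → ¬ PosArc G σ D x y
      independent = proj₁ (proj₂ (proj₂ (kernelPerfect S)))

      absorbing : ∀ {x} → x ∈ S → x ∉ U → ∃[ y ] (y ∈ U × PosArc G σ D x y)
      absorbing = proj₂ (proj₂ (proj₂ (kernelPerfect S)))

      U⊆R : U ⊆ R
      U⊆R x∈U = proj₁ (x∈p∩q⁻ R _ (U⊆S x∈U))

      c∈l-on-U : ∀ {x} → x ∈ U → c ∈ˡ l x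
      c∈l-on-U x∈U = ∈-satisfying⁻ (λ x → c ∈ˡ? l x) (proj₂ (x∈p∩q⁻ R _ (U⊆S x∈U)))

      ∈S : ∀ {x} → x ∈ R → c ∈ˡ l x → x ∈ S
      ∈S x∈R c∈ = x∈p∩q⁺ (x∈R , ∈-satisfying⁺ (λ x → c ∈ˡ? l x) c∈)

      U-nonempty : ∃[ x ] x ∈ U
      U-nonempty with v₀ ∈? U
      ... | yes v₀∈U = v₀ , v₀∈U
      ... | no  v₀∉U with y , y∈U , _ ← absorbing (∈S v₀∈R c∈l) v₀∉U = y , y∈U

      R′ : Subset n
      R′ = R ─ U

      R′⊂R : R′ ⊂ R
      R′⊂R with x , x∈U ← U-nonempty = p∩q≢∅⇒p─q⊂p R U (x , x∈p∩q⁺ (U⊆R x∈U , x∈U))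

      posDeg negDeg : Fin n → ℕ
      posDeg = signedDegInto pos U
      negDeg = signedDegInto neg U

      l⁻ l′ : Fin n → List ℤ
      l⁻ w = withoutIfPositive _≟ℤ_ (negDeg w) (- c) (l w)
      l′ w = without _≟ℤ_ c (l⁻ w)

      l′⊆l : ∀ {w x} → x ∈ˡ l′ w → x ∈ˡ l w
      l′⊆l {w} x∈ = ∈-withoutIfPositive⁻ _≟ℤ_ (negDeg w) (proj₁ (∈-without⁻ _≟ℤ_ {xs = l⁻ w} x∈))

      l⁻-unique : ∀ w → Unique (l⁻ w)
      l⁻-unique w = withoutIfPositive-unique _≟ℤ_ (negDeg w) (uniq w)

      l′-unique : ∀ w → Unique (l′ w)
      l′-unique w = without-unique _≟ℤ_ (l⁻-unique w)

      posDeg-pays-c : ∀ {w} → w ∈ R′ → c ∈ˡ l w → 1 ≤ posDeg w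
      posDeg-pays-c {w} w∈R′ c∈
        with y , y∈U , arc ← absorbing (∈S (p─q⊆p R U w∈R′) c∈) (x∈p─q⇒x∉q w∈R′) =
        posArc⇒posDegInto y∈U arc

      l′-long : ∀ {w} → w ∈ R′ → suc (degInto R′ w) ≤ length (l′ w)
      l′-long {w} w∈R′ = +-cancelʳ-≤ (posDeg w + negDeg w) _ _ (begin
        suc (degInto R′ w) + (posDeg w + negDeg w) ≡⟨ cong suc (degInto-─ U⊆R w) ⟨
        suc (degInto R w)                          ≤⟨ long (p─q⊆p R U w∈R′) ⟩
        length (l w)                               ≤⟨ length-withoutIfPositive _≟ℤ_ (negDeg w) (uniq w) ⟩
        negDeg w + length (l⁻ w)                   ≤⟨ +-monoʳ-≤ (negDeg w) c-paid ⟩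
        negDeg w + (posDeg w + length (l′ w))      ≡⟨ rearrange (negDeg w) (posDeg w) (length (l′ w)) ⟩
        length (l′ w) + (posDeg w + negDeg w)      ∎)
        where
        open ≤-Reasoning
        c-paid : length (l⁻ w) ≤ posDeg w + length (l′ w)
        c-paid = length-without _≟ℤ_ (posDeg w) (l⁻-unique w)
                   (posDeg-pays-c w∈R′ ∘ ∈-withoutIfPositive⁻ _≟ℤ_ (negDeg w))
        rearrange : ∀ a b c → a + (b + c) ≡ c + (b + a)
        rearrange = solve-∀

      l′-avoids : ∀ {w x} s → (s ≡ neg → 1 ≤ negDeg w) → x ∈ˡ l′ w → x ≢ signℤ s *ℤ c
      l′-avoids {w} pos _ x∈ x≡c =
        proj₂ (∈-without⁻ _≟ℤ_ {xs = l⁻ w} x∈) (trans x≡c (*ℤ-identityˡ c))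
      l′-avoids {w} neg paid x∈ x≡-c =
        withoutIfPositive-avoids _≟ℤ_ (paid refl) (proj₁ (∈-without⁻ _≟ℤ_ {xs = l⁻ w} x∈))
          (trans x≡-c (-1*i≡-i c))

      same-colour-ok : ∀ e → end₁ G e ∈ U → end₂ G e ∈ U → c ≢ signℤ (σ e) *ℤ c
      same-colour-ok e x∈U y∈U with σ e in σe
      ... | pos = λ _ → [ independent x∈U y∈U , independent y∈U x∈U ]′ (posEdge⇒posArc e σe)
      ... | neg = λ c≡-c → i≢-i c≢0 (trans c≡-c (-1*i≡-i c))

      colouring′ : Σ (Fin n → ℤ) λ ψ → (∀ {v} → v ∈ R′ → ψ v ∈ˡ l′ v) × ProperOn R′ ψ
      colouring′ = rec R′⊂R l′ l′-unique (λ w 0∈ → no0 w (l′⊆l 0∈)) l′-long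

      ψ′ : Fin n → ℤ
      ψ′ = proj₁ colouring′

      ψ′∈l′ : ∀ {v} → v ∈ R → v ∉ U → ψ′ v ∈ˡ l′ v
      ψ′∈l′ v∈R v∉U = proj₁ (proj₂ colouring′) (x∈p∧x∉q⇒x∈p─q v∈R v∉U)

      ψ : Fin n → ℤ
      ψ x = if does (x ∈? U) then c else ψ′ x

      ψ∈l : ∀ {v} → v ∈ R → ψ v ∈ˡ l v
      ψ∈l {v} v∈R with v ∈? U
      ... | yes v∈U = c∈l-on-U v∈U
      ... | no  v∉U = l′⊆l (ψ′∈l′ v∈R v∉U)

      ψ-proper : ProperOn R ψ
      ψ-proper e x∈R y∈R with end₁ G e ∈? U | end₂ G e ∈? U
      ... | yes x∈U | yes y∈U = same-colour-ok e x∈U y∈U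
      ... | yes x∈U | no  y∉U = λ c≡ → l′-avoids (σ e)
              (λ σe≡neg → negEdge⇒negDegInto₂ e σe≡neg (negBoth e σe≡neg) x∈U)
              (ψ′∈l′ y∈R y∉U) (signℤ-flip (σ e) c≡)
      ... | no  x∉U | yes y∈U = l′-avoids (σ e)
              (λ σe≡neg → negEdge⇒negDegInto₁ e σe≡neg (negBoth e σe≡neg) y∈U)
              (ψ′∈l′ x∈R x∉U)
      ... | no  x∉U | no  y∉U = proj₂ (proj₂ colouring′) e
              (x∈p∧x∉q⇒x∈p─q x∈R x∉U) (x∈p∧x∉q⇒x∈p─q y∈R y∉U)

    kernelStep : ∀ R → WfRec _⊂_ DegreeColourable R → DegreeColourable R
    kernelStep R rec l uniq no0 long with nonempty? R
    ... | no R-empty =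
      (λ _ → 0ℤ) , (λ v∈R → ⊥-elim (R-empty (_ , v∈R))) , (λ e x∈R _ → ⊥-elim (R-empty (_ , x∈R)))
    ... | yes (v₀ , v₀∈R) with c , c∈l ← nonempty-list (long v₀∈R) =
      ψ , ψ∈l , ψ-proper
      where open KernelStep rec l uniq no0 long v₀∈R c∈l

    degreeColourable : ∀ R → DegreeColourable R
    degreeColourable = WF.All.wfRec ⊂-wellFounded 0ℓ DegreeColourable kernelStep

    listColourable : (l : Fin n → List ℤ) → (∀ v → Unique (l v)) → (∀ v → 0ℤ ∉ˡ l v) →
                     (∀ v → suc (outdeg G D v) ≤ length (l v)) →
                     Σ (Fin n → ℤ) λ ψ → (∀ v → ψ v ∈ˡ l v) ×
                       (∀ e → ψ (end₁ G e) ≢ signℤ (σ e) *ℤ ψ (end₂ G e))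
    listColourable l uniq no0 long
      with ψ , ψ∈l , proper ← degreeColourable ⊤ l uniq no0
                                (λ {v} _ → subst (λ d → suc d ≤ length (l v)) (sym (degInto-⊤ v)) (long v))
      = ψ , (λ v → ψ∈l ∈⊤) , (λ e → proper e ∈⊤ ∈⊤)

corollary4p1 : ∀ {n m : ℕ} (G : Multigraph n m) (σ : Fin m → Sign)
    (D : Fin m → Orient) →
    (∀ e → σ e ≡ neg → D e ≡ both) →
    KernelPerfect (PosArc G σ D) →
    (L : Fin n → Pred ℤ 0ℓ) →
    (∀ v → ¬ L v 0ℤ) →
    (∀ v → HasAtLeast (suc (outdeg G D v)) (L v)) →
    Colorable G σ L
corollary4p1 G σ D negBoth kernelPerfect L 0∉L largeL
  with l , l-unique , l-length , l⊆L ← distinctLists {L = L} largeL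
  with ψ , ψ∈l , proper ← Biorientation.listColourable G σ D negBoth kernelPerfect l l-unique
                            (λ v → 0∉L v ∘ l⊆L v) (λ v → ≤-reflexive (sym (l-length v)))
  = ψ , (λ v → l⊆L v (ψ∈l v)) , proper
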